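{- Let $T_e$ be the disjoint union of a triangle and an edge (5 vertices, 4 edges). Then $g(n,T_e)=O(\log n)$ as $n\to\infty$.
   Context: For a positive integer $n$ and a graph $H$: for each vertex $v$ of the complete graph $K_n$ let $f_v$ be a (not necessarily proper) colouring of the edges of the same $K_n$. The collection $\{f_v\}$ is called $(n,H)$-local if for every copy $T$ of $H$ in $K_n$ (i.e. every subgraph of $K_n$ isomorphic to $H$), there exists a vertex $u\in V(T)$ such that all edges of $T$ receive pairwise different colours in $f_u$. $g(n,H)$ is the smallest $k$ for which there is an $(n,H)$-local collection of colourings each using at most $k$ colours. -}

module Defs where

open import Data.Nat using (ℕ)
open import Data.Fin using (Fin)
open import Data.Product using (Σ; _×_; ∃-syntax)
open import Data.Sum using (_⊎_)
open import Relation.Binary.PropositionalEquality using (_≡_; _≢_)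

-- An edge colouring of K_n with (at most) k colours: a symmetric function
-- on pairs of vertices; only its values on pairs of distinct vertices matter.
record Colouring (n k : ℕ) : Set where
  field
    col : Fin n → Fin n → Fin k
    sym : ∀ i j → col i j ≡ col j i
open Colouring public

AllDistinct4 : ∀ {k} → Fin k → Fin k → Fin k → Fin k → Set
AllDistinct4 x y z w =
  x ≢ y × x ≢ z × x ≢ w × y ≢ z × y ≢ w × z ≢ w

Distinct5 : ∀ {n} → Fin n → Fin n → Fin n → Fin n → Fin n → Set
Distinct5 a b c d e =
  a ≢ b × a ≢ c × a ≢ d × a ≢ e × b ≢ c × b ≢ d × b ≢ e × c ≢ d × c ≢ e × d ≢ e

RainbowTe : ∀ {n k} → Colouring n k → Fin n → Fin n → Fin n → Fin n → Fin n → Set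
RainbowTe f a b c d e =
  AllDistinct4 (col f a b) (col f b c) (col f a c) (col f d e)

TeLocal : ∀ {n k} → (Fin n → Colouring n k) → Set
TeLocal {n} f =
  (a b c d e : Fin n) → Distinct5 a b c d e →
  ∃[ u ] ((u ≡ a ⊎ u ≡ b ⊎ u ≡ c ⊎ u ≡ d ⊎ u ≡ e) × RainbowTe (f u) a b c d e)

{-# OPTIONS --safe #-}
-- Give every vertex a binary code of length K = 1 + ⌊log₂ n⌋ and let the level of a pair be
-- the number of coordinates from the first one where their codes differ to the end (0 if equal).
-- Because the alphabet has two letters, every triangle is sharply isosceles: one pair {y, z} has
-- a strictly smaller level than the other two.  Vertex u colours an edge through u by its level
-- (at most K), and any other edge ij by K plus the smaller of the levels of ui and uj, so 2K + 1
-- colours suffice.  In f_y the triangle yzw gets colours level y z, level y w, K + level y z, so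
-- it is rainbow unless the disjoint edge de sees y at level y z as well; but then one of d, e
-- meets z below level y z, and in f_z the edge de gets a colour below K + level y z.
module Submission where

open import Defs
open import Data.Nat using (ℕ; _≤_; _*_)
open import Data.Nat.Logarithm using (⌊log₂_⌋)
open import Data.Fin using (Fin)
open import Data.Product using (∃-syntax)

open import Data.Bool using (Bool; true; false)
open import Data.Empty using (⊥-elim)
open import Data.Fin using (toℕ; fromℕ<)
open import Data.Fin.Properties using (toℕ-fromℕ<; fromℕ<-cong; toℕ-injective; toℕ<n)
open import Data.Nat using (zero; suc; _+_; _<_; _^_; _%_; _/_; _⊓_; _≡ᵇ_; z≤n; s≤s)
open import Data.Nat.DivMod using (m≡m%n+[m/n]*n; m%n<n; m<n*o⇒m/o<n)
open import Data.Nat.Logarithm using (⌊log₂⌋-mono-≤; ⌊log₂[2^n]⌋≡n)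
open import Data.Nat.Properties
open import Data.Nat.Tactic.RingSolver using (solve-∀)
open import Data.Product using (_×_; _,_)
open import Data.Sum using (_⊎_; inj₁; inj₂)
open import Data.Vec using (Vec; []; _∷_)
open import Data.Vec.Properties using (∷-injectiveˡ; ∷-injectiveʳ)
open import Function using (_∘_)
open import Function.Definitions using (Injective)
open import Relation.Binary.PropositionalEquality as ≡
  using (_≡_; _≢_; ≢-sym; refl; cong; cong₂; subst; module ≡-Reasoning)
open import Relation.Nullary using (yes; no)

δ : ∀ {K} → Vec Bool K → Vec Bool K → ℕ
δ [] [] = 0
δ (true ∷ xs) (true ∷ ys) = δ xs ys
δ (false ∷ xs) (false ∷ ys) = δ xs ys
δ {suc K} (true ∷ xs) (false ∷ ys) = suc K
δ {suc K} (false ∷ xs) (true ∷ ys) = suc K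

δ≤K : ∀ {K} (xs ys : Vec Bool K) → δ xs ys ≤ K
δ≤K [] [] = z≤n
δ≤K (true ∷ xs) (true ∷ ys) = m≤n⇒m≤1+n (δ≤K xs ys)
δ≤K (false ∷ xs) (false ∷ ys) = m≤n⇒m≤1+n (δ≤K xs ys)
δ≤K (true ∷ xs) (false ∷ ys) = ≤-refl
δ≤K (false ∷ xs) (true ∷ ys) = ≤-refl

δ-refl : ∀ {K} (xs : Vec Bool K) → δ xs xs ≡ 0
δ-refl [] = refl
δ-refl (true ∷ xs) = δ-refl xs
δ-refl (false ∷ xs) = δ-refl xs

δ-sym : ∀ {K} (xs ys : Vec Bool K) → δ xs ys ≡ δ ys xs
δ-sym [] [] = refl
δ-sym (true ∷ xs) (true ∷ ys) = δ-sym xs ys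
δ-sym (false ∷ xs) (false ∷ ys) = δ-sym xs ys
δ-sym (true ∷ xs) (false ∷ ys) = refl
δ-sym (false ∷ xs) (true ∷ ys) = refl

δ-positive : ∀ {K} {xs ys : Vec Bool K} → xs ≢ ys → 0 < δ xs ys
δ-positive {xs = []} {[]} xs≢ys = ⊥-elim (xs≢ys refl)
δ-positive {xs = true ∷ xs} {true ∷ ys} xs≢ys = δ-positive (xs≢ys ∘ cong (true ∷_))
δ-positive {xs = false ∷ xs} {false ∷ ys} xs≢ys = δ-positive (xs≢ys ∘ cong (false ∷_))
δ-positive {xs = true ∷ xs} {false ∷ ys} _ = s≤s z≤n
δ-positive {xs = false ∷ xs} {true ∷ ys} _ = s≤s z≤n

δ-isosceles : ∀ {K} (xs ys zs : Vec Bool K) →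
              δ xs ys ≡ δ xs zs → xs ≢ ys → δ ys zs < δ xs ys
δ-isosceles [] [] [] _ xs≢ys = ⊥-elim (xs≢ys refl)
δ-isosceles (true ∷ xs) (true ∷ ys) (true ∷ zs) eq xs≢ys =
  δ-isosceles xs ys zs eq (xs≢ys ∘ cong (true ∷_))
δ-isosceles (false ∷ xs) (false ∷ ys) (false ∷ zs) eq xs≢ys =
  δ-isosceles xs ys zs eq (xs≢ys ∘ cong (false ∷_))
δ-isosceles (true ∷ xs) (true ∷ ys) (false ∷ zs) eq _ = ⊥-elim (<⇒≢ (s≤s (δ≤K xs ys)) eq)
δ-isosceles (false ∷ xs) (false ∷ ys) (true ∷ zs) eq _ = ⊥-elim (<⇒≢ (s≤s (δ≤K xs ys)) eq)
δ-isosceles (true ∷ xs) (false ∷ ys) (true ∷ zs) eq _ = ⊥-elim (<⇒≢ (s≤s (δ≤K xs zs)) (≡.sym eq))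
δ-isosceles (false ∷ xs) (true ∷ ys) (false ∷ zs) eq _ = ⊥-elim (<⇒≢ (s≤s (δ≤K xs zs)) (≡.sym eq))
δ-isosceles (true ∷ xs) (false ∷ ys) (false ∷ zs) _ _ = s≤s (δ≤K ys zs)
δ-isosceles (false ∷ xs) (true ∷ ys) (true ∷ zs) _ _ = s≤s (δ≤K ys zs)

ClosestPair : ∀ {K} → Vec Bool K → Vec Bool K → Vec Bool K → Set
ClosestPair xs ys zs = δ xs ys < δ xs zs × δ xs ys < δ ys zs

closestPair : ∀ {K} (xs ys zs : Vec Bool K) → xs ≢ ys → xs ≢ zs → ys ≢ zs →
              ClosestPair xs ys zs ⊎ ClosestPair xs zs ys ⊎ ClosestPair ys zs xs
closestPair [] [] [] xs≢ys _ _ = ⊥-elim (xs≢ys refl)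
closestPair (true ∷ xs) (true ∷ ys) (true ∷ zs) xs≢ys xs≢zs ys≢zs =
  closestPair xs ys zs (xs≢ys ∘ cong (true ∷_)) (xs≢zs ∘ cong (true ∷_)) (ys≢zs ∘ cong (true ∷_))
closestPair (false ∷ xs) (false ∷ ys) (false ∷ zs) xs≢ys xs≢zs ys≢zs =
  closestPair xs ys zs (xs≢ys ∘ cong (false ∷_)) (xs≢zs ∘ cong (false ∷_)) (ys≢zs ∘ cong (false ∷_))
closestPair (true ∷ xs) (true ∷ ys) (false ∷ zs) _ _ _ = inj₁ (s≤s (δ≤K xs ys) , s≤s (δ≤K xs ys))
closestPair (false ∷ xs) (false ∷ ys) (true ∷ zs) _ _ _ = inj₁ (s≤s (δ≤K xs ys) , s≤s (δ≤K xs ys))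
closestPair (true ∷ xs) (false ∷ ys) (true ∷ zs) _ _ _ = inj₂ (inj₁ (s≤s (δ≤K xs zs) , s≤s (δ≤K xs zs)))
closestPair (false ∷ xs) (true ∷ ys) (false ∷ zs) _ _ _ = inj₂ (inj₁ (s≤s (δ≤K xs zs) , s≤s (δ≤K xs zs)))
closestPair (true ∷ xs) (false ∷ ys) (false ∷ zs) _ _ _ = inj₂ (inj₂ (s≤s (δ≤K ys zs) , s≤s (δ≤K ys zs)))
closestPair (false ∷ xs) (true ∷ ys) (true ∷ zs) _ _ _ = inj₂ (inj₂ (s≤s (δ≤K ys zs) , s≤s (δ≤K ys zs)))

bits : (K : ℕ) → ℕ → Vec Bool K
bits zero x = []
bits (suc K) x = (x % 2 ≡ᵇ 0) ∷ bits K (x / 2)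

binaryDigit-injective : ∀ {a b} → a < 2 → b < 2 → (a ≡ᵇ 0) ≡ (b ≡ᵇ 0) → a ≡ b
binaryDigit-injective {0} {0} _ _ _ = refl
binaryDigit-injective {1} {1} _ _ _ = refl
binaryDigit-injective {0} {1} _ _ ()
binaryDigit-injective {1} {0} _ _ ()
binaryDigit-injective {suc (suc _)} (s≤s (s≤s ())) _ _
binaryDigit-injective {b = suc (suc _)} _ (s≤s (s≤s ())) _

bits-injective : ∀ K {x y} → x < 2 ^ K → y < 2 ^ K → bits K x ≡ bits K y → x ≡ y
bits-injective zero {0} {0} _ _ _ = refl
bits-injective zero {suc _} (s≤s ()) _ _
bits-injective zero {y = suc _} _ (s≤s ()) _
bits-injective (suc K) {x} {y} x< y< eq = begin
  x                   ≡⟨ m≡m%n+[m/n]*n x 2 ⟩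
  x % 2 + x / 2 * 2   ≡⟨ cong₂ (λ r q → r + q * 2) lowDigit highDigits ⟩
  y % 2 + y / 2 * 2   ≡⟨ ≡.sym (m≡m%n+[m/n]*n y 2) ⟩
  y                   ∎
  where
  open ≡-Reasoning
  half< : ∀ {z} → z < 2 ^ suc K → z / 2 < 2 ^ K
  half< {z} z< = m<n*o⇒m/o<n (subst (z <_) (*-comm 2 (2 ^ K)) z<)
  lowDigit : x % 2 ≡ y % 2
  lowDigit = binaryDigit-injective (m%n<n x 2) (m%n<n y 2) (∷-injectiveˡ eq)
  highDigits : x / 2 ≡ y / 2
  highDigits = bits-injective K (half< x<) (half< y<) (∷-injectiveʳ eq)

n<2^[1+⌊log₂n⌋] : ∀ n → n < 2 ^ suc ⌊log₂ n ⌋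
n<2^[1+⌊log₂n⌋] n with 2 ^ suc ⌊log₂ n ⌋ ≤? n
... | no 2^[1+⌊log₂n⌋]≰n = ≰⇒> 2^[1+⌊log₂n⌋]≰n
... | yes 2^[1+⌊log₂n⌋]≤n = ⊥-elim (1+n≰n (begin
  suc ⌊log₂ n ⌋               ≡⟨ ⌊log₂[2^n]⌋≡n (suc ⌊log₂ n ⌋) ⟨
  ⌊log₂ 2 ^ suc ⌊log₂ n ⌋ ⌋   ≤⟨ ⌊log₂⌋-mono-≤ 2^[1+⌊log₂n⌋]≤n ⟩
  ⌊log₂ n ⌋                   ∎))
  where open ≤-Reasoning

1≤⌊log₂n⌋ : ∀ {n} → 2 ≤ n → 1 ≤ ⌊log₂ n ⌋
1≤⌊log₂n⌋ {n} 2≤n = subst (_≤ ⌊log₂ n ⌋) (⌊log₂[2^n]⌋≡n 1) (⌊log₂⌋-mono-≤ 2≤n)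

binaryCode : (n : ℕ) → Fin n → Vec Bool (suc ⌊log₂ n ⌋)
binaryCode n x = bits (suc ⌊log₂ n ⌋) (toℕ x)

binaryCode-injective : ∀ n → Injective _≡_ _≡_ (binaryCode n)
binaryCode-injective n {x} {y} = toℕ-injective ∘ bits-injective _ (< x) (< y)
  where
  < : (z : Fin n) → toℕ z < 2 ^ suc ⌊log₂ n ⌋
  < z = <-trans (toℕ<n z) (n<2^[1+⌊log₂n⌋] n)

AllDistinct4-swap₂₃ : ∀ {k} {x y z w : Fin k} → AllDistinct4 x y z w → AllDistinct4 x z y w
AllDistinct4-swap₂₃ (x≢y , x≢z , x≢w , y≢z , y≢w , z≢w) =
  x≢z , x≢y , x≢w , ≢-sym y≢z , z≢w , y≢w

AllDistinct4-swap₁₃ : ∀ {k} {x y z w : Fin k} → AllDistinct4 x y z w → AllDistinct4 z y x w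
AllDistinct4-swap₁₃ (x≢y , x≢z , x≢w , y≢z , y≢w , z≢w) =
  ≢-sym y≢z , ≢-sym x≢z , z≢w , ≢-sym x≢y , y≢w , x≢w

AllDistinct4-split : ∀ {k t} {x y z w : Fin k} →
                     toℕ x ≤ t → toℕ y ≤ t → t < toℕ z → t < toℕ w →
                     toℕ x ≢ toℕ y → toℕ z ≢ toℕ w → AllDistinct4 x y z w
AllDistinct4-split x≤t y≤t t<z t<w x≢y z≢w =
  x≢y ∘ cong toℕ , apart x≤t t<z , apart x≤t t<w ,
  apart y≤t t<z , apart y≤t t<w , z≢w ∘ cong toℕ
  where
  apart : ∀ {k t} {a b : Fin k} → toℕ a ≤ t → t < toℕ b → a ≢ b
  apart a≤t t<b = <⇒≢ (≤-<-trans a≤t t<b) ∘ cong toℕ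

module _ {n k : ℕ} (f : Colouring n k) {a b c d e : Fin n} where

  RainbowTe-swapˡ : RainbowTe f a b c d e → RainbowTe f b a c d e
  RainbowTe-swapˡ rainbow rewrite Colouring.sym f b a = AllDistinct4-swap₂₃ rainbow

  RainbowTe-swapʳ : RainbowTe f a b c d e → RainbowTe f a c b d e
  RainbowTe-swapʳ rainbow rewrite Colouring.sym f c b = AllDistinct4-swap₁₃ rainbow

module LocalColouring {n K : ℕ} (code : Fin n → Vec Bool K)
                      (code-injective : Injective _≡_ _≡_ code) (M : ℕ) (K+K<M : K + K < M) where

  level : Fin n → Fin n → ℕ
  level x y = δ (code x) (code y)

  level-positive : ∀ {x y} → x ≢ y → 0 < level x y
  level-positive x≢y = δ-positive (x≢y ∘ code-injective)

  -- A zero level means the endpoint is u itself, so the first two clauses colour the edges at u.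
  tint : ℕ → ℕ → ℕ
  tint zero q = q
  tint (suc p) zero = suc p
  tint (suc p) (suc q) = K + suc (p ⊓ q)

  tint-comm : ∀ p q → tint p q ≡ tint q p
  tint-comm zero zero = refl
  tint-comm zero (suc q) = refl
  tint-comm (suc p) zero = refl
  tint-comm (suc p) (suc q) = cong (λ m → K + suc m) (⊓-comm p q)

  tint≤K+K : ∀ {p q} → p ≤ K → q ≤ K → tint p q ≤ K + K
  tint≤K+K {zero} _ q≤K = ≤-trans q≤K (m≤m+n K K)
  tint≤K+K {suc p} {zero} p≤K _ = ≤-trans p≤K (m≤m+n K K)
  tint≤K+K {suc p} {suc q} p≤K _ = +-monoʳ-≤ K (≤-trans (s≤s (m⊓n≤m p q)) p≤K)

  tint-far : ∀ {p q} → 0 < p → 0 < q → tint p q ≡ K + p ⊓ q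
  tint-far {suc p} {suc q} _ _ = refl

  K<tint : ∀ {p q} → 0 < p → 0 < q → K < tint p q
  K<tint {suc p} {suc q} _ _ = m<m+n K (s≤s z≤n)

  hue : Fin n → Fin n → Fin n → ℕ
  hue u i j = tint (level u i) (level u j)

  hue<M : ∀ u i j → hue u i j < M
  hue<M u i j = ≤-<-trans (tint≤K+K (δ≤K (code u) (code i)) (δ≤K (code u) (code j))) K+K<M

  -- Opaque so that col (f u) i j stays neutral and the vertices of a RainbowTe can be inferred.
  opaque
    f : Fin n → Colouring n M
    f u = record
      { col = λ i j → fromℕ< (hue<M u i j)
      ; sym = λ i j → fromℕ<-cong _ _ (tint-comm (level u i) (level u j)) _ _
      }

    toℕ-col : ∀ u i j → toℕ (col (f u) i j) ≡ hue u i j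
    toℕ-col u i j = toℕ-fromℕ< (hue<M u i j)

  toℕ-col-at : ∀ u j → toℕ (col (f u) u j) ≡ level u j
  toℕ-col-at u j rewrite toℕ-col u u j | δ-refl (code u) = refl

  toℕ-col-away : ∀ {u i j} → u ≢ i → u ≢ j → toℕ (col (f u) i j) ≡ K + level u i ⊓ level u j
  toℕ-col-away {u} {i} {j} u≢i u≢j =
    ≡.trans (toℕ-col u i j) (tint-far (level-positive u≢i) (level-positive u≢j))

  K<toℕ-col-away : ∀ {u i j} → u ≢ i → u ≢ j → K < toℕ (col (f u) i j)
  K<toℕ-col-away {u} {i} {j} u≢i u≢j =
    subst (K <_) (≡.sym (toℕ-col u i j)) (K<tint (level-positive u≢i) (level-positive u≢j))

  rainbowAt : ∀ {u v w d e} → u ≢ v → u ≢ w → u ≢ d → u ≢ e →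
              level u v ≢ level u w →
              level u v ⊓ level u w ≢ level u d ⊓ level u e →
              RainbowTe (f u) v u w d e
  rainbowAt {u} {v} {w} {d} {e} u≢v u≢w u≢d u≢e uv≢uw minima≢ =
    AllDistinct4-split
      (≤-trans (≤-reflexive vu) (δ≤K (code u) (code v)))
      (≤-trans (≤-reflexive uw) (δ≤K (code u) (code w)))
      (K<toℕ-col-away u≢v u≢w) (K<toℕ-col-away u≢d u≢e)
      (λ eq → uv≢uw (≡.trans (≡.sym vu) (≡.trans eq uw)))
      (λ eq → minima≢ (+-cancelˡ-≡ K _ _
        (≡.trans (≡.sym (toℕ-col-away u≢v u≢w)) (≡.trans eq (toℕ-col-away u≢d u≢e)))))
    where
    vu : toℕ (col (f u) v u) ≡ level u v
    vu = ≡.trans (cong toℕ (Colouring.sym (f u) v u)) (toℕ-col-at u v)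
    uw : toℕ (col (f u) u w) ≡ level u w
    uw = toℕ-col-at u w

  closestPairRainbow : ∀ {y z w d e} → y ≢ z → y ≢ w → z ≢ w → y ≢ d → y ≢ e → z ≢ d → z ≢ e →
                       ClosestPair (code y) (code z) (code w) →
                       RainbowTe (f y) y z w d e ⊎ RainbowTe (f z) y z w d e
  closestPairRainbow {y} {z} {w} {d} {e} y≢z y≢w z≢w y≢d y≢e z≢d z≢e (yz<yw , yz<zw)
    with level y d ⊓ level y e ≟ level y z
  ... | no yde≢yz = inj₁ (RainbowTe-swapˡ (f y) (rainbowAt y≢z y≢w y≢d y≢e (<⇒≢ yz<yw)
          (λ eq → yde≢yz (≡.sym (≡.trans (≡.sym (m≤n⇒m⊓n≡m (<⇒≤ yz<yw))) eq)))))
  ... | yes yde≡yz = inj₂ (rainbowAt (≢-sym y≢z) z≢w z≢d z≢e (<⇒≢ zy<zw)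
          (λ eq → <⇒≢ zde<zy (≡.trans (≡.sym eq) (m≤n⇒m⊓n≡m (<⇒≤ zy<zw)))))
    where
    zy≡yz : level z y ≡ level y z
    zy≡yz = δ-sym (code z) (code y)
    zy<zw : level z y < level z w
    zy<zw = subst (_< level z w) (≡.sym zy≡yz) yz<zw
    nearerZ : ∀ {x} → level y x ≡ level y z → level z x < level z y
    nearerZ yx≡yz = subst (_ <_) (≡.sym zy≡yz)
      (δ-isosceles (code y) (code z) _ (≡.sym yx≡yz) (y≢z ∘ code-injective))
    zde<zy : level z d ⊓ level z e < level z y
    zde<zy with ⊓-sel (level y d) (level y e)
    ... | inj₁ min≡yd = ≤-<-trans (m⊓n≤m _ _) (nearerZ (≡.trans (≡.sym min≡yd) yde≡yz))
    ... | inj₂ min≡ye = ≤-<-trans (m⊓n≤n _ _) (nearerZ (≡.trans (≡.sym min≡ye) yde≡yz))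

  local : TeLocal f
  local a b c d e (a≢b , a≢c , a≢d , a≢e , b≢c , b≢d , b≢e , c≢d , c≢e , _)
    with closestPair (code a) (code b) (code c)
           (a≢b ∘ code-injective) (a≢c ∘ code-injective) (b≢c ∘ code-injective)
  ... | inj₁ ab-closest
    with closestPairRainbow a≢b a≢c b≢c a≢d a≢e b≢d b≢e ab-closest
  ... | inj₁ rainbow = a , inj₁ refl , rainbow
  ... | inj₂ rainbow = b , inj₂ (inj₁ refl) , rainbow
  local a b c d e (a≢b , a≢c , a≢d , a≢e , b≢c , b≢d , b≢e , c≢d , c≢e , _)
    | inj₂ (inj₁ ac-closest)
    with closestPairRainbow a≢c a≢b (≢-sym b≢c) a≢d a≢e c≢d c≢e ac-closest
  ... | inj₁ rainbow = a , inj₁ refl , RainbowTe-swapʳ (f a) rainbow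
  ... | inj₂ rainbow = c , inj₂ (inj₂ (inj₁ refl)) , RainbowTe-swapʳ (f c) rainbow
  local a b c d e (a≢b , a≢c , a≢d , a≢e , b≢c , b≢d , b≢e , c≢d , c≢e , _)
    | inj₂ (inj₂ bc-closest)
    with closestPairRainbow b≢c (≢-sym a≢b) (≢-sym a≢c) b≢d b≢e c≢d c≢e bc-closest
  ... | inj₁ rainbow = b , inj₂ (inj₁ refl) ,
                        RainbowTe-swapˡ (f b) (RainbowTe-swapʳ (f b) rainbow)
  ... | inj₂ rainbow = c , inj₂ (inj₂ (inj₁ refl)) ,
                        RainbowTe-swapˡ (f c) (RainbowTe-swapʳ (f c) rainbow)

2[1+L]<5L : ∀ {L} → 1 ≤ L → suc L + suc L < 5 * L
2[1+L]<5L {suc l} _ = ≤-trans (m≤m+n _ (3 * l)) (≤-reflexive ([2l+5]+3l≡5[1+l] l))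
  where
  [2l+5]+3l≡5[1+l] : ∀ l → suc (suc (suc l) + suc (suc l)) + 3 * l ≡ 5 * suc l
  [2l+5]+3l≡5[1+l] = solve-∀

theorem2p3 : ∃[ C ] ∃[ N ] ((n : ℕ) → N ≤ n →
               ∃[ f ] TeLocal {n} {C * ⌊log₂ n ⌋} f)
theorem2p3 = 5 , 2 , λ n 2≤n →
  let open LocalColouring (binaryCode n) (binaryCode-injective n)
                          (5 * ⌊log₂ n ⌋) (2[1+L]<5L (1≤⌊log₂n⌋ 2≤n))
  in f , local
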